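{- Let $n \geq 2$, $p, m \in \mathbb{N}$, and let $G_1,\ldots,G_n$ be vertex-disjoint graphs. For each $i \in [n]$ let $\{u_{i,1},\ldots,u_{i,p}\}$ be a clique in $G_i$, and let $G$ be obtained from the disjoint union of $G_1,\ldots,G_n$ by identifying $u_{1,q},\ldots,u_{n,q}$ as a single vertex $u_q$ for each $q \in [p]$. Suppose that for each $i \in [n]$ there is a number $k_i$ such that for every $m$-fold cover $\mathcal{D}_i=(K_i,D_i)$ of $G_i$ and every independent set $A$ of $D_i$ with $A \subseteq \bigcup_{q=1}^{p} K_i(u_{i,q})$ and $|A \cap K_i(u_{i,q})| = 1$ for each $q \in [p]$, the set $A$ is contained in at least $k_i$ $\mathcal{D}_i$-colorings of $G_i$. Then \[ P_{DP}(G,m) \geq \left(\prod_{j=0}^{p-1} (m-j)\right)\left(\prod_{i=1}^{n} k_i\right). \]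
   Context: All graphs are finite and simple. A cover of a graph $G$ is a pair $\mathcal{H}=(L,H)$ where $H$ is a graph and $L: V(G) \to \mathcal{P}(V(H))$ satisfies: (1) $\{L(u): u \in V(G)\}$ is a partition of $V(H)$ into $|V(G)|$ parts; (2) $H[L(u)]$ is complete for each $u$; (3) if there is an edge of $H$ between $L(u)$ and $L(v)$ with $u \neq v$, then $uv \in E(G)$; (4) if $uv \in E(G)$, the edges of $H$ between $L(u)$ and $L(v)$ form a (possibly empty) matching. The cover is $m$-fold if $|L(u)|=m$ for all $u$. An $\mathcal{H}$-coloring of $G$ is an independent set of $H$ of size $|V(G)|$ (equivalently, an independent set meeting each $L(u)$ in exactly one vertex). $P_{DP}(G,m)$ is the minimum number of $\mathcal{H}$-colorings of $G$ over all $m$-fold covers $\mathcal{H}$ of $G$. -}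

module Defs where

open import Function using (_∘_)
open import Data.Nat using (ℕ; zero; suc; _*_)
open import Data.Fin using (Fin; zero; suc; _≟_)
open import Data.Fin.Properties using (any?)
open import Data.Bool using (Bool; true; false; T; not; _∨_)
open import Data.Product using (Σ; _×_; _,_)
open import Data.Sum using (_⊎_; inj₁; inj₂)
open import Relation.Nullary using (yes; no)
open import Relation.Nullary.Decidable using (⌊_⌋)
open import Relation.Binary.PropositionalEquality using (_≡_; _≢_; refl)

prodFin : (n : ℕ) → (Fin n → ℕ) → ℕ
prodFin zero    f = 1
prodFin (suc n) f = f zero * prodFin n (f ∘ suc)

anyFin : (n : ℕ) → (Fin n → Bool) → Bool
anyFin zero    f = false
anyFin (suc n) f = f zero ∨ anyFin n (f ∘ suc)

Adj : Set → Set
Adj V = V → V → Bool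

record Graph (N : ℕ) : Set where
  field
    adj    : Adj (Fin N)
    sym    : ∀ x y → adj x y ≡ adj y x
    irrefl : ∀ x → adj x x ≡ false

-- H has vertex set V × Fin m, L(u) = {u} × Fin m (complete inside each L(u));
-- M u v a b = true means (u,a)(v,b) is an edge of H for u ≠ v.
record Cover {V : Set} (E : Adj V) (m : ℕ) : Set where
  field
    M       : V → V → Fin m → Fin m → Bool
    M-sym   : ∀ u v a b → M u v a b ≡ M v u b a
    M-edge  : ∀ u v a b → M u v a b ≡ true → E u v ≡ true
    M-match : ∀ u v a b b′ → M u v a b ≡ true → M u v a b′ ≡ true → b ≡ b′

-- an H-coloring: an independent set of H meeting every L(u) exactly once,
-- i.e. a choice c(u) ∈ L(u) with no H-edges between chosen vertices
IsColoring : {V : Set} {E : Adj V} {m : ℕ} → Cover E m → (V → Fin m) → Set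
IsColoring {V} H c = ∀ (u v : V) → u ≢ v → Cover.M H u v (c u) (c v) ≡ false

AtLeast : {V : Set} {m : ℕ} → ℕ → ((V → Fin m) → Set) → Set
AtLeast {V} {m} k P =
  Σ (Fin k → V → Fin m) λ f →
    (∀ i → P (f i)) × (∀ i j → (∀ v → f i v ≡ f j v) → i ≡ j)

module Glue (n : ℕ) (N : Fin n → ℕ) (Gs : (i : Fin n) → Graph (N i))
            (p : ℕ) (u : (i : Fin n) → Fin p → Fin (N i)) where

  inClique : (i : Fin n) → Fin (N i) → Bool
  inClique i x = ⌊ any? (λ q → u i q ≟ x) ⌋

  -- vertices: the identified u_q, or a non-clique vertex of some G_i
  GlueV : Set
  GlueV = Fin p ⊎ Σ (Fin n) (λ i → Σ (Fin (N i)) (λ x → T (not (inClique i x))))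

  glueAdj : Adj GlueV
  glueAdj (inj₁ q) (inj₁ q′) = anyFin n (λ i → Graph.adj (Gs i) (u i q) (u i q′))
  glueAdj (inj₁ q) (inj₂ (i , x , _)) = Graph.adj (Gs i) (u i q) x
  glueAdj (inj₂ (i , x , _)) (inj₁ q) = Graph.adj (Gs i) x (u i q)
  glueAdj (inj₂ (i , x , _)) (inj₂ (j , y , _)) with i ≟ j
  ... | yes refl = Graph.adj (Gs i) x y
  ... | no _     = false

glueAdj : (n : ℕ) (N : Fin n → ℕ) (Gs : (i : Fin n) → Graph (N i))
          (p : ℕ) (u : (i : Fin n) → Fin p → Fin (N i)) → Adj (Glue.GlueV n N Gs p u)
glueAdj = Glue.glueAdj

-- Colour the p identified vertices first. In a cover every vertex of a fibre has at most one
-- neighbour in each other fibre, so colouring them greedily the j-th vertex loses at most j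
-- colours, which gives ∏ (m − j) colourings. Because the u_{i,q} form a clique in every G_i,
-- each edge of G between images of vertices of G_i is an edge of G_i, so H restricts to a cover
-- of G_i in which a fixed colouring of the identified vertices is independent; it therefore
-- extends in at least k_i ways inside G_i. Since G has no other edges between different G_i, any
-- choice of extensions glues to an H-colouring of G, and distinct choices glue to distinct ones.
module Submission where

open import Defs
open import Function using (_∘_; id)
open import Function.Bundles using (Injection)
open import Function.Definitions using (Injective)
open import Function.Properties.Inverse using (↔⇒↣)
open import Data.Nat using (ℕ; zero; suc; _≤_; _*_; _∸_)
open import Data.Nat.Properties using (∸-+-assoc)
open import Data.Fin using (Fin; zero; suc; toℕ; _≟_; remQuot; punchIn; inject₁)
open import Data.Fin.Properties using (any?; *↔×; punchIn-injective; punchInᵢ≢i; inject₁-injective)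
open import Data.Bool using (Bool; true; false; T; not)
open import Data.Bool.Properties using (¬-not; T-irrelevant)
import Data.Bool.Properties as Bool
open import Data.Product using (Σ; ∃-syntax; _×_; _,_; proj₁; proj₂; uncurry)
open import Data.Sum using (_⊎_; inj₁; inj₂; [_,_]′)
open import Data.Unit using (tt)
open import Data.Vec.Functional using (_∷_)
open import Relation.Nullary using (yes; no; contradiction)
open import Relation.Nullary.Decidable using (toWitnessFalse)
open import Relation.Binary.PropositionalEquality

AtLeast-weaken : ∀ {V m k} {P Q : (V → Fin m) → Set}
  → (∀ c → P c → Q c) → AtLeast k P → AtLeast k Q
AtLeast-weaken P⇒Q (c , valid , distinct) = c , (λ i → P⇒Q (c i) (valid i)) , distinct

remQuot-injective : ∀ {A} B (i j : Fin (A * B)) → remQuot {A} B i ≡ remQuot B j → i ≡ j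
remQuot-injective B i j = Injection.injective (↔⇒↣ *↔×)

AtLeast-* : ∀ {V m A B} (P : (V → Fin m) → Set) (f : Fin A → Fin B → V → Fin m)
  → (∀ α β → P (f α β))
  → (∀ α β α′ β′ → (∀ v → f α β v ≡ f α′ β′ v) → α ≡ α′ × β ≡ β′)
  → AtLeast (A * B) P
AtLeast-* {A = A} {B} P f valid distinct =
  uncurry f ∘ remQuot B , uncurry valid ∘ remQuot B ,
  λ i j eq → remQuot-injective B i j (distinct′ (remQuot B i) (remQuot B j) eq)
  where
  distinct′ : ∀ x y → (∀ v → uncurry f x v ≡ uncurry f y v) → x ≡ y
  distinct′ (α , β) (α′ , β′) eq with distinct α β α′ β′ eq
  ... | refl , refl = refl

AtLeast-extend : ∀ {V W m A B} {P : (W → Fin m) → Set} {Q : (V → Fin m) → Set} (ι : W → V)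
  → AtLeast A P
  → (∀ a → P a → AtLeast B (λ c → Q c × (∀ w → c (ι w) ≡ a w)))
  → AtLeast (A * B) Q
AtLeast-extend {V} {W} {m} {A} {B} {Q = Q} ι (a , a-valid , a-distinct) extend =
  AtLeast-* Q c (λ α β → proj₁ (c-valid α β)) distinct
  where
  extension : ∀ α → AtLeast B (λ c → Q c × (∀ w → c (ι w) ≡ a α w))
  extension α = extend (a α) (a-valid α)
  c : Fin A → Fin B → V → Fin m
  c α = proj₁ (extension α)
  c-valid : ∀ α β → Q (c α β) × (∀ w → c α β (ι w) ≡ a α w)
  c-valid α = proj₁ (proj₂ (extension α))
  restrictions-agree : ∀ α β α′ β′ → (∀ v → c α β v ≡ c α′ β′ v) → ∀ w → a α w ≡ a α′ w
  restrictions-agree α β α′ β′ eq w =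
    trans (sym (proj₂ (c-valid α β) w)) (trans (eq (ι w)) (proj₂ (c-valid α′ β′) w))
  distinct : ∀ α β α′ β′ → (∀ v → c α β v ≡ c α′ β′ v) → α ≡ α′ × β ≡ β′
  distinct α β α′ β′ eq with refl ← a-distinct α α′ (restrictions-agree α β α′ β′ eq) =
    refl , proj₂ (proj₂ (extension α)) β β′ eq

prodFin-cong : ∀ n {f g : Fin n → ℕ} → (∀ j → f j ≡ g j) → prodFin n f ≡ prodFin n g
prodFin-cong zero    eq = refl
prodFin-cong (suc n) eq = cong₂ _*_ (eq zero) (prodFin-cong n (eq ∘ suc))

prodFin-split : ∀ n (k : Fin n → ℕ) → Fin (prodFin n k) → (i : Fin n) → Fin (k i)
prodFin-split (suc n) k J zero    = proj₁ (remQuot {k zero} (prodFin n (k ∘ suc)) J)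
prodFin-split (suc n) k J (suc i) =
  prodFin-split n (k ∘ suc) (proj₂ (remQuot {k zero} (prodFin n (k ∘ suc)) J)) i

prodFin-split-injective : ∀ n (k : Fin n → ℕ) (J J′ : Fin (prodFin n k))
  → (∀ i → prodFin-split n k J i ≡ prodFin-split n k J′ i) → J ≡ J′
prodFin-split-injective zero    k zero zero eq = refl
prodFin-split-injective (suc n) k J    J′   eq =
  remQuot-injective {k zero} (prodFin n (k ∘ suc)) J J′
    (cong₂ _,_ (eq zero) (prodFin-split-injective n (k ∘ suc) _ _ (eq ∘ suc)))

anyFin-false : ∀ n {f : Fin n → Bool} → (∀ i → f i ≡ false) → anyFin n f ≡ false
anyFin-false zero    _       = refl
anyFin-false (suc n) f≡false rewrite f≡false zero = anyFin-false n (f≡false ∘ suc)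

AtMostOne : {A : Set} → (A → Bool) → Set
AtMostOne P = ∀ x y → P x ≡ true → P y ≡ true → x ≡ y

avoid-atMostOne : ∀ {r} (P : Fin r → Bool) → AtMostOne P
  → Σ (Fin (r ∸ 1) → Fin r) λ h → Injective _≡_ _≡_ h × (∀ j → P (h j) ≡ false)
avoid-atMostOne {zero}  P _ = (λ ()) , (λ { {()} }) , (λ ())
avoid-atMostOne {suc r} P unique with any? (λ x → P x Bool.≟ true)
... | yes (x , Px) = punchIn x , punchIn-injective x _ _ ,
                     λ j → ¬-not (λ Pj → punchInᵢ≢i x j (unique _ _ Pj Px))
... | no ∄         = inject₁ , inject₁-injective , λ j → ¬-not (λ Pj → ∄ (inject₁ j , Pj))

pullback : ∀ {V W : Set} {m} {E : Adj V} {F : Adj W} (f : W → V)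
  → (∀ x y → E (f x) (f y) ≡ true → F x y ≡ true) → Cover E m → Cover F m
pullback f reflects C = record
  { M       = λ x y → M (f x) (f y)
  ; M-sym   = λ x y → M-sym (f x) (f y)
  ; M-edge  = λ x y a b → reflects x y ∘ M-edge (f x) (f y) a b
  ; M-match = λ x y → M-match (f x) (f y)
  }
  where open Cover C

M-nonadjacent : ∀ {V : Set} {m} {E : Adj V} (C : Cover E m) {x y a b}
  → E x y ≡ false → Cover.M C x y a b ≡ false
M-nonadjacent C {x} {y} {a} {b} x≁y with Cover.M C x y a b in eq
... | true  = contradiction (trans (sym (Cover.M-edge C x y a b eq)) x≁y) λ ()
... | false = refl

FromLists : ∀ {p r m} → (Fin p → Fin r → Fin m) → (Fin p → Fin m) → Set
FromLists L c = ∀ q → ∃[ β ] c q ≡ L q β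

listColorings : ∀ {p r m} {E : Adj (Fin p)} (C : Cover E m) (L : Fin p → Fin r → Fin m)
  → (∀ q → Injective _≡_ _≡_ (L q))
  → AtLeast (prodFin p (λ j → r ∸ toℕ j)) (λ c → IsColoring C c × FromLists L c)
listColorings {zero} C L _ = (λ _ ()) , (λ _ → (λ ()) , (λ ())) , λ { zero zero _ → refl }
listColorings {suc p} {r} {m} {E} C L L-injective =
  subst (λ k → AtLeast k Valid) (cong (r *_) (prodFin-cong p λ j → ∸-+-assoc r 1 (toℕ j)))
    (AtLeast-* Valid coloring valid distinct)
  where
  open Cover C
  Valid : (Fin (suc p) → Fin m) → Set
  Valid c = IsColoring C c × FromLists L c
  avoid : ∀ α q → Σ (Fin (r ∸ 1) → Fin r) λ h →
    Injective _≡_ _≡_ h × (∀ γ → M zero (suc q) (L zero α) (L (suc q) (h γ)) ≡ false)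
  avoid α q = avoid-atMostOne (λ β → M zero (suc q) (L zero α) (L (suc q) β))
                              (λ β β′ e e′ → L-injective (suc q) (M-match _ _ _ _ _ e e′))
  tailCover : Cover (λ q q′ → E (suc q) (suc q′)) m
  tailCover = pullback suc (λ _ _ → id) C
  tailLists : Fin r → Fin p → Fin (r ∸ 1) → Fin m
  tailLists α q = L (suc q) ∘ proj₁ (avoid α q)
  rest : ∀ α → AtLeast (prodFin p (λ j → (r ∸ 1) ∸ toℕ j))
                       (λ c → IsColoring tailCover c × FromLists (tailLists α) c)
  rest α = listColorings tailCover (tailLists α)
                         (λ q → proj₁ (proj₂ (avoid α q)) ∘ L-injective (suc q))
  coloring : Fin r → Fin (prodFin p (λ j → (r ∸ 1) ∸ toℕ j)) → Fin (suc p) → Fin m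
  coloring α β = L zero α ∷ proj₁ (rest α) β
  valid : ∀ α β → Valid (coloring α β)
  valid α β = isColoring , fromLists
    where
    restValid : IsColoring tailCover (proj₁ (rest α) β)
              × FromLists (tailLists α) (proj₁ (rest α) β)
    restValid = proj₁ (proj₂ (rest α)) β
    afterZero : ∀ q → M zero (suc q) (L zero α) (coloring α β (suc q)) ≡ false
    afterZero q with γ , eq ← proj₂ restValid q rewrite eq = proj₂ (proj₂ (avoid α q)) γ
    isColoring : IsColoring C (coloring α β)
    isColoring zero    zero     ne = contradiction refl ne
    isColoring zero    (suc q′) _  = afterZero q′
    isColoring (suc q) zero     _  = trans (M-sym _ _ _ _) (afterZero q)
    isColoring (suc q) (suc q′) ne = proj₁ restValid q q′ (ne ∘ cong suc)
    fromLists : FromLists L (coloring α β)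
    fromLists zero    = α , refl
    fromLists (suc q) with γ , eq ← proj₂ restValid q = proj₁ (avoid α q) γ , eq
  distinct : ∀ α β α′ β′ → (∀ q → coloring α β q ≡ coloring α′ β′ q) → α ≡ α′ × β ≡ β′
  distinct α β α′ β′ eq with refl ← L-injective zero (eq zero) =
    refl , proj₂ (proj₂ (rest α)) β β′ (eq ∘ suc)

colorings-fallingFactorial : ∀ {p m} {E : Adj (Fin p)} (C : Cover E m)
  → AtLeast (prodFin p (λ j → m ∸ toℕ j)) (IsColoring C)
colorings-fallingFactorial C =
  AtLeast-weaken {P = λ c → IsColoring C c × FromLists (λ _ → id) c} (λ _ → proj₁)
    (listColorings C (λ _ → id) (λ _ → id))

module Gluing {n p : ℕ} {N : Fin n → ℕ} (Gs : (i : Fin n) → Graph (N i))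
  (u : (i : Fin n) → Fin p → Fin (N i))
  (u-injective : ∀ i q q′ → u i q ≡ u i q′ → q ≡ q′)
  (clique : ∀ i q q′ → q ≢ q′ → Graph.adj (Gs i) (u i q) (u i q′) ≡ true)
  where

  open Glue n N Gs p u using (GlueV; inClique)

  G : Adj GlueV
  G = glueAdj n N Gs p u

  position : ∀ i x → (∃[ q ] u i q ≡ x) ⊎ T (not (inClique i x))
  position i x with any? (λ q → u i q ≟ x)
  ... | yes found = inj₁ found
  ... | no _      = inj₂ tt

  embed : (i : Fin n) → Fin (N i) → GlueV
  embed i x = [ inj₁ ∘ proj₁ , (λ t → inj₂ (i , x , t)) ]′ (position i x)

  embed-clique : ∀ i q → embed i (u i q) ≡ inj₁ q
  embed-clique i q with position i (u i q)
  ... | inj₁ (q′ , eq) = cong inj₁ (u-injective i q′ q eq)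
  ... | inj₂ t         = contradiction (q , refl) (toWitnessFalse t)

  embed-outside : ∀ i x (t : T (not (inClique i x))) → embed i x ≡ inj₂ (i , x , t)
  embed-outside i x t with position i x
  ... | inj₁ found = contradiction found (toWitnessFalse t)
  ... | inj₂ t′    = cong (λ t → inj₂ (i , x , t)) (T-irrelevant t′ t)

  G-irrefl : ∀ v → G v v ≡ false
  G-irrefl (inj₁ q) = anyFin-false n λ i → Graph.irrefl (Gs i) (u i q)
  G-irrefl (inj₂ (i , x , _)) with i ≟ i
  ... | yes refl = Graph.irrefl (Gs i) x
  ... | no _     = refl

  G-acrossBlocks : ∀ {i j x y s t} → i ≢ j → G (inj₂ (i , x , s)) (inj₂ (j , y , t)) ≡ false
  G-acrossBlocks {i} {j} i≢j with i ≟ j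
  ... | yes i≡j = contradiction i≡j i≢j
  ... | no _    = refl

  embed-reflects : ∀ i x y → G (embed i x) (embed i y) ≡ true → Graph.adj (Gs i) x y ≡ true
  embed-reflects i x y with position i x | position i y
  ... | inj₁ (q , refl) | inj₁ (q′ , refl) = λ e → clique i q q′ λ where
          refl → contradiction (trans (sym e) (G-irrefl (inj₁ q))) λ ()
  ... | inj₁ (q , refl) | inj₂ _           = id
  ... | inj₂ _          | inj₁ (q′ , refl) = id
  ... | inj₂ _          | inj₂ _ with i ≟ i
  ...   | yes refl = id
  ...   | no i≢i   = contradiction refl i≢i

  glue : ∀ {m} → (Fin p → Fin m) → ((i : Fin n) → Fin (N i) → Fin m) → GlueV → Fin m
  glue a c (inj₁ q)           = a q
  glue a c (inj₂ (i , x , _)) = c i x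

  glue-embed : ∀ {m} {a : Fin p → Fin m} {c : (i : Fin n) → Fin (N i) → Fin m} i
    → (∀ q → c i (u i q) ≡ a q) → ∀ x → glue a c (embed i x) ≡ c i x
  glue-embed i extends x with position i x
  ... | inj₁ (q , refl) = sym (extends q)
  ... | inj₂ _          = refl

  module _ {m} (H : Cover G m) where

    cliqueCover : Cover (λ q q′ → G (inj₁ q) (inj₁ q′)) m
    cliqueCover = pullback inj₁ (λ _ _ → id) H

    blockCover : (i : Fin n) → Cover (Graph.adj (Gs i)) m
    blockCover i = pullback (embed i) (embed-reflects i) H

    cliqueColoring-independent : ∀ {a} → IsColoring cliqueCover a
      → ∀ i q q′ → q ≢ q′ → Cover.M (blockCover i) (u i q) (u i q′) (a q) (a q′) ≡ false
    cliqueColoring-independent a-col i q q′ q≢q′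
      rewrite embed-clique i q | embed-clique i q′ = a-col q q′ q≢q′

    glue-isColoring : ∀ {a c} → IsColoring cliqueCover a → (∀ i → IsColoring (blockCover i) (c i))
      → (∀ i q → c i (u i q) ≡ a q) → IsColoring H (glue a c)
    glue-isColoring {a} {c} a-col c-col extends = colors
      where
      withinBlock : ∀ i {x y v w} → embed i x ≡ v → embed i y ≡ w → v ≢ w
        → Cover.M H v w (glue a c v) (glue a c w) ≡ false
      withinBlock i {x} {y} refl refl v≢w =
        subst₂ (λ cx cy → Cover.M H (embed i x) (embed i y) cx cy ≡ false)
          (sym (glue-embed i (extends i) x)) (sym (glue-embed i (extends i) y))
          (c-col i x y (v≢w ∘ cong (embed i)))
      colors : IsColoring H (glue a c)
      colors (inj₁ q) (inj₁ q′) v≢w = a-col q q′ (v≢w ∘ cong inj₁)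
      colors (inj₁ q) (inj₂ (i , y , t)) v≢w =
        withinBlock i (embed-clique i q) (embed-outside i y t) v≢w
      colors (inj₂ (i , x , s)) (inj₁ q) v≢w =
        withinBlock i (embed-outside i x s) (embed-clique i q) v≢w
      colors (inj₂ (i , x , s)) (inj₂ (j , y , t)) v≢w with i ≟ j
      ... | yes refl = withinBlock i (embed-outside i x s) (embed-outside i y t) v≢w
      ... | no i≢j   = M-nonadjacent H (G-acrossBlocks {s = s} {t} i≢j)

    extensions : ∀ {a} {k : Fin n → ℕ} → IsColoring cliqueCover a
      → (∀ i → AtLeast (k i) (λ c → IsColoring (blockCover i) c × (∀ q → c (u i q) ≡ a q)))
      → AtLeast (prodFin n k) (λ c → IsColoring H c × (∀ q → c (inj₁ q) ≡ a q))
    extensions {a} {k} a-col ext = coloring , valid , distinct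
      where
      choice : Fin (prodFin n k) → (i : Fin n) → Fin (N i) → Fin m
      choice J i = proj₁ (ext i) (prodFin-split n k J i)
      chosen : ∀ J i → IsColoring (blockCover i) (choice J i) × (∀ q → choice J i (u i q) ≡ a q)
      chosen J i = proj₁ (proj₂ (ext i)) (prodFin-split n k J i)
      coloring : Fin (prodFin n k) → GlueV → Fin m
      coloring J = glue a (choice J)
      valid : ∀ J → IsColoring H (coloring J) × (∀ q → coloring J (inj₁ q) ≡ a q)
      valid J = glue-isColoring a-col (proj₁ ∘ chosen J) (proj₂ ∘ chosen J) , λ _ → refl
      distinct : ∀ J J′ → (∀ v → coloring J v ≡ coloring J′ v) → J ≡ J′
      distinct J J′ eq = prodFin-split-injective n k J J′ λ i →
        proj₂ (proj₂ (ext i)) _ _ λ x →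
          trans (sym (glue-embed i (proj₂ (chosen J i)) x))
                (trans (eq (embed i x)) (glue-embed i (proj₂ (chosen J′ i)) x))

lemma1p11 : (n : ℕ) → 2 ≤ n → (p m : ℕ)
  → (N : Fin n → ℕ) (Gs : (i : Fin n) → Graph (N i))
  → (u : (i : Fin n) → Fin p → Fin (N i))
  → (∀ i q q′ → u i q ≡ u i q′ → q ≡ q′)
  → (∀ i q q′ → q ≢ q′ → Graph.adj (Gs i) (u i q) (u i q′) ≡ true)
  → (k : Fin n → ℕ)
  → (∀ i (D : Cover (Graph.adj (Gs i)) m) (a : Fin p → Fin m)
       → (∀ q q′ → q ≢ q′ → Cover.M D (u i q) (u i q′) (a q) (a q′) ≡ false)
       → AtLeast (k i) (λ c → IsColoring D c × (∀ q → c (u i q) ≡ a q)))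
  → (H : Cover (glueAdj n N Gs p u) m)
  → AtLeast (prodFin p (λ j → m ∸ toℕ j) * prodFin n k) (IsColoring H)
lemma1p11 n _ p m N Gs u u-injective clique k extend H =
  AtLeast-extend {Q = IsColoring H} inj₁ (colorings-fallingFactorial (cliqueCover H)) λ a a-col →
    extensions H a-col λ i → extend i (blockCover H i) a (cliqueColoring-independent H a-col i)
  where open Gluing Gs u u-injective clique
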